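{- Let $G$ be a finite simple graph and let $f,g\colon V(G)\to\mathbb{N}$ with $g(v)\le f(v)$ for every $v\in V(G)$. If $G$ is weak$^*$ $f$-degenerate, then there is a subset $X\subseteq V(G)$ such that the induced subgraph $G[X]$ is weak$^*$ $g|_X$-degenerate and $G-X$ is weak$^*$ $(f-g)|_{V(G)-X}$-degenerate.
   Context: $\mathbb{N}=\{0,1,2,\dots\}$. Consider pairs $(G,f)$ with $G$ a finite simple graph and $f\colon V(G)\to\mathbb{N}$; the pair $(\emptyset,\emptyset)$ denotes the graph with no vertices. For $x\in V(G)$ let $f_{ -x}\colon V(G)-\{x\}\to\mathbb{Z}$ be $f_{ -x}(v)=f(v)-1$ if $v$ is adjacent to $x$ and $f_{ -x}(v)=f(v)$ otherwise. Define three operations: (1) Reduce-value: for a vertex $x$ and a positive integer $s$, $\mathsf{ReduceValue}_{x,s}(G,f)=(G,f')$ where $f'$ agrees with $f$ except $f'(x)=f(x)-s$; it is legal if $f(x)>s$. (2) Edge-deletion: for an edge $xy$ (ordered as $(x,y)$), $\mathsf{EdgeDelete}_{(x,y)}(G,f)=(G-xy,f')$ where $f'$ agrees with $f$ except $f'(x)=f(x)-f(y)$; it is legal if $f(x)>f(y)$. (3) Vertex-deletion: for a vertex $x$, $\mathsf{VertexDelete}_x(G,f)=(G-x,f_{ -x})$; it is legal if $f(x)>0$ (if $G$ has the single vertex $x$, the result is $(\emptyset,\emptyset)$). $G$ is called weak$^*$ $f$-degenerate if either $(G,f)=(\emptyset,\emptyset)$, or some legal operation of one of these three types transforms $(G,f)$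 into a pair $(G',f')$ with $G'$ weak$^*$ $f'$-degenerate; equivalently, some finite sequence of legal operations transforms $(G,f)$ into $(\emptyset,\emptyset)$. -}

module Defs where

open import Data.Nat using (ℕ)
open import Data.Bool using (Bool; true; false; _∧_; not; if_then_else_)
open import Data.Fin using (Fin; _≟_)
open import Data.Integer using (ℤ; +_; _-_; _<_; 1ℤ; 0ℤ)
open import Relation.Nullary using (does)
open import Relation.Binary.PropositionalEquality using (_≡_)

record SimpleGraph (n : ℕ) : Set where
  field
    Adj   : Fin n → Fin n → Bool
    sym   : ∀ u v → Adj u v ≡ Adj v u
    irrefl : ∀ v → Adj v v ≡ false

open SimpleGraph public

-- A "configuration" is a graph given by an ambient vertex set Fin n, a set of
-- present vertices  alive : Fin n → Bool  and an adjacency relation  adj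
-- (only edges between present vertices count), together with a value
-- function  h : Fin n → ℤ  (values on absent vertices are irrelevant).
-- Values are integers because f_{-x} may become negative.

update : ∀ {n} {A : Set} → (Fin n → A) → Fin n → A → Fin n → A
update h x a v = if does (v ≟ x) then a else h v

removeEdge : ∀ {n} → (Fin n → Fin n → Bool) → Fin n → Fin n → Fin n → Fin n → Bool
removeEdge adj x y u v =
  if (does (u ≟ x) ∧ does (v ≟ y)) then false else
  (if (does (u ≟ y) ∧ does (v ≟ x)) then false else adj u v)

minusNbr : ∀ {n} → (Fin n → Fin n → Bool) → Fin n → (Fin n → ℤ) → Fin n → ℤ
minusNbr adj x h v = if adj v x then h v - 1ℤ else h v

data Degen {n : ℕ} : (Fin n → Bool) → (Fin n → Fin n → Bool) → (Fin n → ℤ) → Set where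
  empty : ∀ {alive adj h} → (∀ v → alive v ≡ false) → Degen alive adj h
  reduceValue : ∀ {alive adj h} (x : Fin n) (s : ℕ) →
    alive x ≡ true → 0ℤ < + s → + s < h x →
    Degen alive adj (update h x (h x - + s)) → Degen alive adj h
  edgeDelete : ∀ {alive adj h} (x y : Fin n) →
    alive x ≡ true → alive y ≡ true → adj x y ≡ true → h y < h x →
    Degen alive (removeEdge adj x y) (update h x (h x - h y)) → Degen alive adj h
  vertexDelete : ∀ {alive adj h} (x : Fin n) →
    alive x ≡ true → 0ℤ < h x →
    Degen (update alive x false) adj (minusNbr adj x h) → Degen alive adj h

InducedWeakStarDegenerate : ∀ {n} → SimpleGraph n → (Fin n → Bool) → (Fin n → ℤ) → Set
InducedWeakStarDegenerate G X h = Degen X (Adj G) h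

WeakStarDegenerate : ∀ {n} → SimpleGraph n → (Fin n → ℤ) → Set
WeakStarDegenerate G h = Degen (λ _ → true) (Adj G) h

-- Induction on a derivation of weak* f-degeneracy.  Deleting a vertex x
-- puts x into X when g(x) > 0 and into the complement otherwise.  Deleting an edge xy with f(x) > f(y)
-- splits f(y) as c + (f(y) - c), where c is g(y) clamped to [0, f(y)], and
-- both sides delete the edge using their share of f(y).  The steps on the
-- two sides stay legal because degeneracy survives raising values and the
-- values of present vertices are always positive.
module Submission where

open import Defs hiding (sym)
open import Data.Nat using (ℕ; _≤_; _∸_)
open import Data.Fin using (Fin)
open import Data.Bool using (Bool; not; true; false; _∧_)
open import Data.Integer using (+_)
open import Data.Product using (Σ; _×_; _,_)

open import Data.Bool.Properties using (∧-zeroʳ)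
open import Data.Empty using (⊥-elim)
open import Data.Fin using (_≟_)
open import Data.Integer using (ℤ; _-_; _+_; -_; 0ℤ; 1ℤ; ∣_∣)
  renaming (_≤_ to _≤ℤ_; _<_ to _<ℤ_)
open import Data.Integer.Properties
  using ( ≤-refl; ≤-reflexive; ≤-trans; ≤-antisym; <⇒≤; <-irrefl; <-trans; <-≤-trans
        ; ≮⇒≥; _<?_; +-identityˡ; +-identityʳ; +-inverseʳ; +-monoˡ-≤; +-monoʳ-≤
        ; +-monoˡ-<; +-monoʳ-<; neg-mono-≤; neg-mono-<; i≤j⇒0≤j-i; i-j≤i
        ; 0≤i⇒+∣i∣≡i; m-n≡m⊖n; ⊖-≥ )
open import Data.Integer.Tactic.RingSolver using (solve-∀)
open import Data.List using (List; []; _∷_; allFin)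
open import Data.List.Membership.Propositional using (_∈_)
open import Data.List.Membership.Propositional.Properties using (∈-allFin)
open import Data.List.Relation.Unary.Any using (here; there)
open import Data.Sum using (_⊎_; inj₁; inj₂)
open import Relation.Nullary using (yes; no)
open import Relation.Nullary.Decidable using (does; dec-false)
open import Relation.Binary.PropositionalEquality
  using (_≡_; _≢_; _≗_; refl; sym; trans; cong; cong₂; subst; subst₂)

i<j⇒0<j-i : ∀ {i j} → i <ℤ j → 0ℤ <ℤ j - i
i<j⇒0<j-i {i} {j} i<j = subst (_<ℤ j - i) (+-inverseʳ i) (+-monoˡ-< (- i) i<j)

0<j-i⇒i<j : ∀ {i j} → 0ℤ <ℤ j - i → i <ℤ j
0<j-i⇒i<j {i} {j} 0<j-i =
  subst₂ _<ℤ_ (+-identityˡ i) ([j-i]+i≡j j i) (+-monoˡ-< i 0<j-i)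
  where
    [j-i]+i≡j : ∀ j i → (j - i) + i ≡ j
    [j-i]+i≡j = solve-∀

0<j⇒i-j<i : ∀ i {j} → 0ℤ <ℤ j → i - j <ℤ i
0<j⇒i-j<i i 0<j = subst (i - _ <ℤ_) (+-identityʳ i) (+-monoʳ-< i (neg-mono-< 0<j))

0≤j⇒i≤i+j : ∀ i {j} → 0ℤ ≤ℤ j → i ≤ℤ i + j
0≤j⇒i≤i+j i {j} 0≤j = subst (_≤ℤ i + j) (+-identityʳ i) (+-monoʳ-≤ i 0≤j)

0<i⇒j<i+j : ∀ {i} j → 0ℤ <ℤ i → j <ℤ i + j
0<i⇒j<i+j {i} j 0<i = subst (_<ℤ i + j) (+-identityˡ j) (+-monoˡ-< j 0<i)

i+j≤k⇒i≤k-j : ∀ {i j k} → i + j ≤ℤ k → i ≤ℤ k - j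
i+j≤k⇒i≤k-j {i} {j} {k} le = subst (_≤ℤ k - j) ([i+j]-j≡i i j) (+-monoˡ-≤ (- j) le)
  where
    [i+j]-j≡i : ∀ i j → (i + j) - j ≡ i
    [i+j]-j≡i = solve-∀

clamp : ∀ c m → 0ℤ ≤ℤ m → Σ ℤ λ d →
  0ℤ ≤ℤ d × d ≤ℤ m × (0ℤ <ℤ d → d ≤ℤ c) × (d <ℤ m → c ≤ℤ d)
clamp c m 0≤m with c <? 0ℤ | m <? c
... | yes c<0 | _ = 0ℤ , ≤-refl , 0≤m , (λ 0<0 → ⊥-elim (<-irrefl refl 0<0)) , (λ _ → <⇒≤ c<0)
... | no c≮0 | yes m<c = m , 0≤m , ≤-refl , (λ _ → <⇒≤ m<c) , (λ m<m → ⊥-elim (<-irrefl refl m<m))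
... | no c≮0 | no m≮c = c , ≮⇒≥ c≮0 , ≮⇒≥ m≮c , (λ _ → ≤-refl) , (λ _ → ≤-refl)

private
  variable
    n : ℕ
    A A' B X : Fin n → Bool
    adj adj' : Fin n → Fin n → Bool
    h h' g lo hi : Fin n → ℤ
    u v x y : Fin n
    L : List (Fin n)

≡true⇒≢false : ∀ {b} → b ≡ true → b ≢ false
≡true⇒≢false refl ()

update-≡ : ∀ {C : Set} (k : Fin n → C) x a → update k x a x ≡ a
update-≡ k x a with x ≟ x
... | yes _ = refl
... | no x≢x = ⊥-elim (x≢x refl)

update-≢ : ∀ {C : Set} (k : Fin n → C) {a} → v ≢ x → update k x a v ≡ k v
update-≢ {v = v} {x = x} k v≢x with v ≟ x
... | yes v≡x = ⊥-elim (v≢x v≡x)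
... | no _ = refl

update-cong : ∀ {C : Set} (k k' : Fin n → C) x {a a'} v →
  (v ≢ x → k v ≡ k' v) → a ≡ a' → update k x a v ≡ update k' x a' v
update-cong _ _ x v k≡k' a≡a' with v ≟ x
... | yes _ = a≡a'
... | no v≢x = k≡k' v≢x

update-≤ : ∀ {a} → a ≤ℤ h x → ∀ v → update h x a v ≤ℤ h v
update-≤ {x = x} a≤hx v with v ≟ x
... | yes refl = a≤hx
... | no _ = ≤-refl

update-false-⊆ : ∀ (A : Fin n → Bool) x v → update A x false v ≡ true → A v ≡ true
update-false-⊆ A x v p with v ≟ x
... | no _ = p

deleted-∉ : (∀ v → X v ≡ true → update A x false v ≡ true) → X x ≡ false
deleted-∉ {X = X} {A = A} {x = x} X⊆ with X x in Xx
... | false = refl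
... | true with () ← trans (sym (X⊆ x Xx)) (update-≡ A x false)

removeEdge-cong : ∀ x y u v → adj u v ≡ adj' u v →
  removeEdge adj x y u v ≡ removeEdge adj' x y u v
removeEdge-cong x y u v = cong (λ b → removeEdge (λ _ _ → b) x y u v)

removeEdge-away : (u ≢ x × v ≢ x) ⊎ (u ≢ y × v ≢ y) → removeEdge adj x y u v ≡ adj u v
removeEdge-away {u = u} {x = x} {v = v} {y = y} (inj₁ (u≢x , v≢x))
  rewrite dec-false (u ≟ x) u≢x | dec-false (v ≟ x) v≢x | ∧-zeroʳ (does (u ≟ y)) = refl
removeEdge-away {u = u} {x = x} {v = v} {y = y} (inj₂ (u≢y , v≢y))
  rewrite dec-false (u ≟ y) u≢y | dec-false (v ≟ y) v≢y | ∧-zeroʳ (does (u ≟ x)) = refl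

minusNbr-cong : ∀ x v → adj v x ≡ adj' v x → h v ≡ h' v →
  minusNbr adj x h v ≡ minusNbr adj' x h' v
minusNbr-cong x v = cong₂ (λ b w → minusNbr (λ _ _ → b) x (λ _ → w) v)

minusNbr-≤ : ∀ v → minusNbr adj x h v ≤ℤ h v
minusNbr-≤ {adj = adj} {x = x} {h = h} v with adj v x
... | true = i-j≤i (h v) 1ℤ
... | false = ≤-refl

minusNbr-cancel : ∀ v → minusNbr adj x h v - minusNbr adj x g v ≡ h v - g v
minusNbr-cancel {adj = adj} {x = x} {h = h} {g = g} v with adj v x
... | true = [i-1]-[j-1]≡i-j (h v) (g v)
  where
    [i-1]-[j-1]≡i-j : ∀ i j → (i - 1ℤ) - (j - 1ℤ) ≡ i - j
    [i-1]-[j-1]≡i-j = solve-∀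
... | false = refl

minusNbr-sub : ∀ v → minusNbr adj x h v - g v ≡ minusNbr adj x (λ w → h w - g w) v
minusNbr-sub {adj = adj} {x = x} {h = h} {g = g} v with adj v x
... | true = [i-1]-j≡[i-j]-1 (h v) (g v)
  where
    [i-1]-j≡[i-j]-1 : ∀ i j → (i - 1ℤ) - j ≡ (i - j) - 1ℤ
    [i-1]-j≡[i-j]-1 = solve-∀
... | false = refl

degen-positive : Degen A adj h → ∀ v → A v ≡ true → 0ℤ <ℤ h v
degen-positive (empty dead) v av = ⊥-elim (≡true⇒≢false av (dead v))
degen-positive {h = h} (reduceValue x s _ 0<s s<hx d) v av with v ≟ x
... | yes refl = <-trans 0<s s<hx
... | no v≢x = subst (0ℤ <ℤ_) (update-≢ h v≢x) (degen-positive d v av)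
degen-positive {A = A} {adj = adj} {h = h} (vertexDelete x _ 0<hx d) v av with v ≟ x
... | yes refl = 0<hx
... | no v≢x =
  <-≤-trans (degen-positive d v (trans (update-≢ A v≢x) av))
            (minusNbr-≤ {adj = adj} {x = x} {h = h} v)
degen-positive {h = h} (edgeDelete x y _ ay _ hy<hx d) v av with v ≟ x
... | yes refl = <-trans (subst (0ℤ <ℤ_) (update-≢ h y≢x) (degen-positive d y ay)) hy<hx
  where
    y≢x : y ≢ x
    y≢x refl = <-irrefl refl hy<hx
... | no v≢x = subst (0ℤ <ℤ_) (update-≢ h v≢x) (degen-positive d v av)

degen-cong : Degen A adj h → A ≗ A' →
  (∀ u v → A u ≡ true → A v ≡ true → adj u v ≡ adj' u v) →
  (∀ v → A v ≡ true → h v ≡ h' v) → Degen A' adj' h'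
degen-cong (empty dead) A≗A' _ _ = empty (λ v → trans (sym (A≗A' v)) (dead v))
degen-cong {h = h} {h' = h'} (reduceValue x s ax 0<s s<hx d) A≗A' adj≡ h≡ =
  reduceValue x s (trans (sym (A≗A' x)) ax) 0<s (subst (+ s <ℤ_) (h≡ x ax) s<hx)
    (degen-cong d A≗A' adj≡ λ v av →
      update-cong h h' x v (λ _ → h≡ v av) (cong (_- + s) (h≡ x ax)))
degen-cong {A = A} {adj = adj} {h = h} {A' = A'} {adj' = adj'} {h' = h'}
    (vertexDelete x ax 0<hx d) A≗A' adj≡ h≡ =
  vertexDelete x (trans (sym (A≗A' x)) ax) (subst (0ℤ <ℤ_) (h≡ x ax) 0<hx)
    (degen-cong d (λ v → update-cong A A' x v (λ _ → A≗A' v) refl)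
      (λ u v au av → adj≡ u v (update-false-⊆ A x u au) (update-false-⊆ A x v av))
      (λ v av → minusNbr-cong {adj = adj} {adj' = adj'} {h = h} {h' = h'} x v
                  (adj≡ v x (update-false-⊆ A x v av) ax) (h≡ v (update-false-⊆ A x v av))))
degen-cong {adj = adj} {h = h} {adj' = adj'} {h' = h'}
    (edgeDelete x y ax ay axy hy<hx d) A≗A' adj≡ h≡ =
  edgeDelete x y (trans (sym (A≗A' x)) ax) (trans (sym (A≗A' y)) ay)
    (trans (sym (adj≡ x y ax ay)) axy) (subst₂ _<ℤ_ (h≡ y ay) (h≡ x ax) hy<hx)
    (degen-cong d A≗A'
      (λ u v au av → removeEdge-cong {adj = adj} {adj' = adj'} x y u v (adj≡ u v au av))
      (λ v av → update-cong h h' x v (λ _ → h≡ v av) (cong₂ _-_ (h≡ x ax) (h≡ y ay))))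

degen-lowerValue : ∀ x {c} → A x ≡ true → 0ℤ <ℤ c → c <ℤ h x →
  Degen A adj (update h x c) → Degen A adj h
degen-lowerValue {A = A} {h = h} {adj = adj} x {c} ax 0<c c<hx d =
  reduceValue x ∣ h x - c ∣ ax (subst (0ℤ <ℤ_) (sym s≡) (i<j⇒0<j-i c<hx))
    (subst (_<ℤ h x) (sym s≡) (0<j⇒i-j<i (h x) 0<c))
    (subst (λ c' → Degen A adj (update h x c'))
      (sym (trans (cong (λ s → h x - s) s≡) (i-[i-j]≡j (h x) c))) d)
  where
    s≡ : + ∣ h x - c ∣ ≡ h x - c
    s≡ = 0≤i⇒+∣i∣≡i (<⇒≤ (i<j⇒0<j-i c<hx))
    i-[i-j]≡j : ∀ i j → i - (i - j) ≡ j
    i-[i-j]≡j = solve-∀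

∷-outside : (A x ≡ true → h x ≡ h' x) →
  (∀ v → A v ≡ true → v ∈ x ∷ L ⊎ h v ≡ h' v) →
  ∀ v → A v ≡ true → v ∈ L ⊎ h v ≡ h' v
∷-outside fixed outside v av with outside v av
... | inj₁ (here refl) = inj₂ (fixed av)
... | inj₁ (there v∈L) = inj₁ v∈L
... | inj₂ hv≡h'v = inj₂ hv≡h'v

-- A larger value function is reached by lowering each raised value back
-- with Reduce-value first, which is legal because present values are positive.
degen-mono-on : (L : List (Fin n)) → Degen A adj h →
  (∀ v → A v ≡ true → h v ≤ℤ h' v) →
  (∀ v → A v ≡ true → v ∈ L ⊎ h v ≡ h' v) → Degen A adj h'
degen-mono-on {h = h} {h' = h'} [] d _ outside =
  degen-cong d (λ _ → refl) (λ _ _ _ _ → refl) λ v av → agree (outside v av)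
  where
    agree : ∀ {v} → v ∈ [] ⊎ h v ≡ h' v → h v ≡ h' v
    agree (inj₂ e) = e
degen-mono-on {A = A} {h = h} {h' = h'} (x ∷ L) d h≤h' outside with A x in ax | h x <? h' x
... | true | yes hx<h'x =
  degen-lowerValue x ax (degen-positive d x ax) hx<h'x (degen-mono-on L d h≤h'₁ outside₁)
  where
    h≤h'₁ : ∀ v → A v ≡ true → h v ≤ℤ update h' x (h x) v
    h≤h'₁ v av with v ≟ x
    ... | yes refl = ≤-refl
    ... | no _ = h≤h' v av
    outside₁ : ∀ v → A v ≡ true → v ∈ L ⊎ h v ≡ update h' x (h x) v
    outside₁ v av with v ≟ x | outside v av
    ... | yes refl | _ = inj₂ refl
    ... | no v≢x | inj₁ (here v≡x) = ⊥-elim (v≢x v≡x)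
    ... | no _ | inj₁ (there v∈L) = inj₁ v∈L
    ... | no _ | inj₂ hv≡h'v = inj₂ hv≡h'v
... | true | no hx≮h'x =
  degen-mono-on L d h≤h' (∷-outside (λ _ → ≤-antisym (h≤h' x ax) (≮⇒≥ hx≮h'x)) outside)
... | false | _ =
  degen-mono-on L d h≤h' (∷-outside (λ ax′ → ⊥-elim (≡true⇒≢false ax′ ax)) outside)

degen-mono : Degen A adj h → (∀ v → A v ≡ true → h v ≤ℤ h' v) → Degen A adj h'
degen-mono d h≤h' = degen-mono-on (allFin _) d h≤h' (λ v _ → inj₁ (∈-allFin v))

present-or-absent : ∀ (B : Fin n → Bool) x y →
  (B x ≡ true × B y ≡ true) ⊎ (B x ≡ false ⊎ B y ≡ false)
present-or-absent B x y with B x | B y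
... | true | true = inj₁ (refl , refl)
... | true | false = inj₂ (inj₂ refl)
... | false | _ = inj₂ (inj₁ refl)

degen-removeEdge-absent : B x ≡ false ⊎ B y ≡ false →
  Degen B (removeEdge adj x y) h → Degen B adj h
degen-removeEdge-absent {B = B} {adj = adj} absent d =
  degen-cong d (λ _ → refl)
    (λ u v bu bv → removeEdge-away {adj = adj} (avoid bu bv absent)) (λ _ _ → refl)
  where
    alive≢absent : ∀ {u z} → B u ≡ true → B z ≡ false → u ≢ z
    alive≢absent bu bz refl = ≡true⇒≢false bu bz
    avoid : ∀ {u v x y} → B u ≡ true → B v ≡ true → B x ≡ false ⊎ B y ≡ false →
      (u ≢ x × v ≢ x) ⊎ (u ≢ y × v ≢ y)
    avoid bu bv (inj₁ bx) = inj₁ (alive≢absent bu bx , alive≢absent bv bx)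
    avoid bu bv (inj₂ by) = inj₂ (alive≢absent bu by , alive≢absent bv by)

-- Deleting xy from the hi-configuration, after lowering hi(y) to lo(y),
-- leaves at least lo(x) at x and lo(y) at y.
degen-restoreEdge : x ≢ y → adj x y ≡ true → Degen B (removeEdge adj x y) lo →
  0ℤ ≤ℤ lo y → lo x + lo y ≤ℤ hi x → (0ℤ <ℤ lo y → lo y ≤ℤ hi y) →
  (∀ v → v ≢ x → v ≢ y → lo v ≤ℤ hi v) → Degen B adj hi
degen-restoreEdge {x = x} {y = y} {B = B} {lo = lo} {hi = hi}
    x≢y axy d 0≤loy sum≤ loy≤ rest with present-or-absent B x y
... | inj₁ (bx , by) =
  degen-mono (edgeDelete x y bx by axy lowered (degen-mono d lo≤)) λ v _ → update-≤ hiy≥loy v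
  where
    hi' : Fin _ → ℤ
    hi' = update hi y (lo y)
    hi'x : hi' x ≡ hi x
    hi'x = update-≢ hi x≢y
    hi'y : hi' y ≡ lo y
    hi'y = update-≡ hi y (lo y)
    lowered : hi' y <ℤ hi' x
    lowered = subst₂ _<ℤ_ (sym hi'y) (sym hi'x)
      (<-≤-trans (0<i⇒j<i+j (lo y) (degen-positive d x bx)) sum≤)
    lo≤ : ∀ v → B v ≡ true → lo v ≤ℤ update hi' x (hi' x - hi' y) v
    lo≤ v _ with v ≟ x | v ≟ y
    ... | yes refl | _ = subst (lo v ≤ℤ_) (sym (cong₂ _-_ hi'x hi'y)) (i+j≤k⇒i≤k-j sum≤)
    ... | no _ | yes refl = ≤-refl
    ... | no v≢x | no v≢y = rest v v≢x v≢y
    hiy≥loy : lo y ≤ℤ hi y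
    hiy≥loy = loy≤ (degen-positive d y by)
... | inj₂ absent = degen-mono (degen-removeEdge-absent absent d) lo≤hi
  where
    lo≤hi : ∀ v → B v ≡ true → lo v ≤ℤ hi v
    lo≤hi v bv with v ≟ x | v ≟ y
    ... | yes refl | _ = ≤-trans (0≤j⇒i≤i+j (lo v) 0≤loy) sum≤
    ... | no _ | yes refl = loy≤ (degen-positive d v bv)
    ... | no v≢x | no v≢y = rest v v≢x v≢y

record Splitting (A : Fin n → Bool) (adj : Fin n → Fin n → Bool) (h g : Fin n → ℤ) : Set where
  constructor splitting
  field
    part       : Fin n → Bool
    part⊆      : ∀ v → part v ≡ true → A v ≡ true
    degen-part : Degen part adj g
    degen-rest : Degen (λ v → A v ∧ not (part v)) adj (λ v → h v - g v)

splitting-empty : (∀ v → A v ≡ false) → Splitting A adj h g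
splitting-empty dead =
  splitting (λ _ → false) (λ _ ()) (empty λ _ → refl) (empty λ v → cong (_∧ true) (dead v))

splitting-mono : (∀ v → h v ≤ℤ h' v) → Splitting A adj h g → Splitting A adj h' g
splitting-mono {g = g} h≤h' (splitting X X⊆A dX dR) =
  splitting X X⊆A dX (degen-mono dR λ v _ → +-monoˡ-≤ (- g v) (h≤h' v))

splitting-deleteInto : A x ≡ true → 0ℤ <ℤ g x →
  Splitting (update A x false) adj (minusNbr adj x h) (minusNbr adj x g) →
  Splitting A adj h g
splitting-deleteInto {A = A} {x = x} {g = g} {adj = adj} {h = h} ax 0<gx (splitting X X⊆ dX dR) =
  splitting (update X x true) X₁⊆A
    (vertexDelete x (update-≡ X x true) 0<gx (degen-cong dX X≗ (λ _ _ _ _ → refl) (λ _ _ → refl)))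
    (degen-cong dR R≗ (λ _ _ _ _ → refl) (λ v _ → minusNbr-cancel {adj = adj} {x} {h} {g} v))
  where
    X₁⊆A : ∀ v → update X x true v ≡ true → A v ≡ true
    X₁⊆A v p with v ≟ x
    ... | yes refl = ax
    ... | no _ = update-false-⊆ A x v (X⊆ v p)
    X≗ : X ≗ update (update X x true) x false
    X≗ v with v ≟ x
    ... | yes refl = deleted-∉ X⊆
    ... | no _ = refl
    R≗ : (λ v → update A x false v ∧ not (X v)) ≗ (λ v → A v ∧ not (update X x true v))
    R≗ v with v ≟ x
    ... | yes refl = sym (∧-zeroʳ (A v))
    ... | no _ = refl

splitting-deleteOutside : A x ≡ true → 0ℤ <ℤ h x → g x ≤ℤ 0ℤ →
  Splitting (update A x false) adj (minusNbr adj x h) g →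
  Splitting A adj h g
splitting-deleteOutside {A = A} {x = x} {h = h} {g = g} {adj = adj}
    ax 0<hx gx≤0 (splitting X X⊆ dX dR) =
  splitting X (λ v p → update-false-⊆ A x v (X⊆ v p)) dX
    (vertexDelete x Rx 0<hx-gx
      (degen-cong dR R≗ (λ _ _ _ _ → refl) (λ v _ → minusNbr-sub {adj = adj} {x} {h} {g} v)))
  where
    Rx : A x ∧ not (X x) ≡ true
    Rx rewrite ax | deleted-∉ X⊆ = refl
    0<hx-gx : 0ℤ <ℤ h x - g x
    0<hx-gx = <-≤-trans 0<hx (0≤j⇒i≤i+j (h x) (neg-mono-≤ gx≤0))
    R≗ : (λ v → update A x false v ∧ not (X v)) ≗ update (λ v → A v ∧ not (X v)) x false
    R≗ v with v ≟ x
    ... | yes refl = refl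
    ... | no _ = refl

splitting-edgeDelete : adj x y ≡ true → h y <ℤ h x → 0ℤ <ℤ h y →
  (∀ g' → Splitting A (removeEdge adj x y) (update h x (h x - h y)) g') →
  Splitting A adj h g
splitting-edgeDelete {adj = adj} {x = x} {y = y} {h = h} {A = A} {g = g}
    axy hy<hx 0<hy split-d with clamp (g y) (h y) (<⇒≤ 0<hy)
... | c , 0≤c , c≤hy , c≤gy , gy≤c with split-d (update (update g y c) x (g x - c))
...   | splitting X X⊆A dX dR =
  splitting X X⊆A
    (degen-restoreEdge x≢y axy dX (subst (0ℤ ≤ℤ_) (sym g'y) 0≤c)
      (≤-reflexive (trans (cong₂ _+_ g'x g'y) ([i-j]+j≡i (g x) c)))
      (subst (λ d → 0ℤ <ℤ d → d ≤ℤ g y) (sym g'y) c≤gy)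
      (λ v v≢x v≢y → ≤-reflexive (g'-other v v≢x v≢y)))
    (degen-restoreEdge x≢y axy dR (subst (0ℤ ≤ℤ_) (sym rest-y) (i≤j⇒0≤j-i c≤hy))
      (≤-reflexive (trans (cong₂ _+_ rest-x rest-y) (shares-sum (h x) (h y) (g x) c)))
      (subst (λ d → 0ℤ <ℤ d → d ≤ℤ h y - g y) (sym rest-y)
        λ 0<hy-c → +-monoʳ-≤ (h y) (neg-mono-≤ (gy≤c (0<j-i⇒i<j 0<hy-c))))
      (λ v v≢x v≢y → ≤-reflexive (cong₂ _-_ (h₁-other v v≢x) (g'-other v v≢x v≢y))))
  where
    x≢y : x ≢ y
    x≢y refl = <-irrefl refl hy<hx
    g' h₁ : Fin _ → ℤ
    g' = update (update g y c) x (g x - c)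
    h₁ = update h x (h x - h y)
    g'x : g' x ≡ g x - c
    g'x = update-≡ (update g y c) x (g x - c)
    g'y : g' y ≡ c
    g'y = trans (update-≢ (update g y c) (λ y≡x → x≢y (sym y≡x))) (update-≡ g y c)
    g'-other : ∀ v → v ≢ x → v ≢ y → g' v ≡ g v
    g'-other v v≢x v≢y = trans (update-≢ (update g y c) v≢x) (update-≢ g v≢y)
    h₁-other : ∀ v → v ≢ x → h₁ v ≡ h v
    h₁-other v v≢x = update-≢ h v≢x
    rest-x : h₁ x - g' x ≡ (h x - h y) - (g x - c)
    rest-x = cong₂ _-_ (update-≡ h x (h x - h y)) g'x
    rest-y : h₁ y - g' y ≡ h y - c
    rest-y = cong₂ _-_ (h₁-other y (λ y≡x → x≢y (sym y≡x))) g'y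
    [i-j]+j≡i : ∀ i j → (i - j) + j ≡ i
    [i-j]+j≡i = solve-∀
    shares-sum : ∀ hx hy gx c → ((hx - hy) - (gx - c)) + (hy - c) ≡ hx - gx
    shares-sum = solve-∀

-- g ranges over all integer functions because the induction passes to g_{-x}.
split : Degen A adj h → ∀ g → Splitting A adj h g
split (empty dead) g = splitting-empty dead
split {h = h} (reduceValue x s _ _ _ d) g =
  splitting-mono (update-≤ (i-j≤i (h x) (+ s))) (split d g)
split {adj = adj} (vertexDelete x ax 0<hx d) g with 0ℤ <? g x
... | yes 0<gx = splitting-deleteInto ax 0<gx (split d (minusNbr adj x g))
... | no 0≮gx = splitting-deleteOutside ax 0<hx (≮⇒≥ 0≮gx) (split d g)
split D@(edgeDelete x y _ ay axy hy<hx d) g =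
  splitting-edgeDelete axy hy<hx (degen-positive D y ay) (split d)

lemma2 : ∀ (n : ℕ) (G : SimpleGraph n) (f g : Fin n → ℕ) →
    (∀ v → g v ≤ f v) →
    WeakStarDegenerate G (λ v → + f v) →
    Σ (Fin n → Bool) (λ X →
    InducedWeakStarDegenerate G X (λ v → + g v) ×
    InducedWeakStarDegenerate G (λ v → not (X v)) (λ v → + (f v ∸ g v)))
lemma2 n G f g g≤f D with split D (λ v → + g v)
... | splitting X _ dX dR =
  X , dX , degen-cong dR (λ _ → refl) (λ _ _ _ _ → refl) (λ v _ → +f-+g≡+[f∸g] v)
  where
    +f-+g≡+[f∸g] : ∀ v → + f v - + g v ≡ + (f v ∸ g v)
    +f-+g≡+[f∸g] v = trans (m-n≡m⊖n (f v) (g v)) (⊖-≥ (g≤f v))
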